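{- Let $E$ be a finite set and $\tau:2^{E}\to2^{E}$ an operator, and for $X\subseteq E$ let $ex(X)=\{x\in X: x\notin\tau(X\setminus\{x\})\}$. (a) If $\tau$ satisfies (C1) $X\subseteq\tau(X)$ for all $X$ and (C22) for all $F\subseteq G\subseteq E$ with $G\subseteq\tau(F)$, $\tau(G)=\tau(F)$ (a violator space), then for every $X\subseteq E$, $ex(X)=\bigcap\{B\subseteq X:\tau(B)=\tau(X)\}$. (b) If $\tau$ satisfies (C1) and (Convexity) for all $X\subseteq Y\subseteq Z\subseteq E$ with $\tau(X)=\tau(Z)$ we have $\tau(Y)=\tau(X)=\tau(Z)$ (a convex space), then for every $X\subseteq E$, $ex(X)\subseteq\bigcap\{B\subseteq X:\tau(B)=\tau(X)\}$. -}

module Defs where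

open import Data.Nat using (ℕ)
open import Data.Fin using (Fin)
open import Data.Fin.Subset using (Subset; _∈_; _∉_; _⊆_; _─_; ⁅_⁆)
open import Data.Product using (_×_)
open import Relation.Binary.PropositionalEquality using (_≡_)

Operator : ℕ → Set
Operator n = Subset n → Subset n

C1 : ∀ {n} → Operator n → Set
C1 {n} τ = ∀ (X : Subset n) → X ⊆ τ X

C22 : ∀ {n} → Operator n → Set
C22 {n} τ = ∀ (F G : Subset n) → F ⊆ G → G ⊆ τ F → τ G ≡ τ F

Convexity : ∀ {n} → Operator n → Set
Convexity {n} τ = ∀ (X Y Z : Subset n) → X ⊆ Y → Y ⊆ Z → τ X ≡ τ Z →
  (τ Y ≡ τ X) × (τ Y ≡ τ Z)

_∈ex[_]_ : ∀ {n} → Fin n → Operator n → Subset n → Set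
x ∈ex[ τ ] X = (x ∈ X) × (x ∉ τ (X ─ ⁅ x ⁆))

_∈⋂bases[_]_ : ∀ {n} → Fin n → Operator n → Subset n → Set
_∈⋂bases[_]_ {n} x τ X = ∀ (B : Subset n) → B ⊆ X → τ B ≡ τ X → x ∈ B

module Submission where

-- The proof rests on one observation: a basis B of X (that is, B ⊆ X with
-- τ(B) = τ(X)) that misses a point x ∈ X satisfies B ⊆ X ∖ {x} ⊆ X.
-- Hence, as soon as τ is constant on every interval between a basis and
-- X ("sandwich stability"), τ(X ∖ {x}) = τ(X) ∋ x, so x is not extreme.
-- Both axiom systems give sandwich stability: for convex spaces it is half
-- of the convexity axiom, for violator spaces it follows from (C22)
-- together with (C1).  This yields ex(X) ⊆ ⋂ bases in both parts.
-- The reverse inclusion for violator spaces: X is a basis of itself, so a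
-- point of every basis lies in X; and if x ∈ τ(X ∖ {x}) then, by (C1),
-- all of X lies in τ(X ∖ {x}), so (C22) makes X ∖ {x} a basis of X that
-- misses x.

open import Defs
open import Data.Nat using (ℕ)
open import Data.Fin using (Fin)
open import Data.Fin.Subset using (Subset; _∈_; _∉_; _⊆_; _─_; ⁅_⁆)
open import Data.Fin.Subset.Properties
  using (_∈?_; x∈⁅x⁆; x∈⁅y⁆⇒x≡y; x∈p∧x∉q⇒x∈p─q; p─q⊆p)
open import Data.Vec using (_∷_; there)
open import Data.Product using (_×_; _,_; proj₂)
open import Function.Bundles using (_⇔_; mk⇔)
open import Relation.Nullary using (¬_; yes; no)
open import Relation.Nullary.Decidable using (decidable-stable)
open import Relation.Binary.PropositionalEquality using (_≡_; refl; sym; trans; subst)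

x∈q⇒x∉p─q : ∀ {n} {x : Fin n} {p q : Subset n} → x ∈ q → x ∉ p ─ q
x∈q⇒x∉p─q {p = _ ∷ p} {q = _ ∷ q} (there x∈q) (there x∈p─q) = x∈q⇒x∉p─q x∈q x∈p─q

⊆-remove : ∀ {n} {x : Fin n} {B X : Subset n} → B ⊆ X → x ∉ B → B ⊆ X ─ ⁅ x ⁆
⊆-remove {x = x} B⊆X x∉B {y} y∈B =
  x∈p∧x∉q⇒x∈p─q (B⊆X y∈B) λ y∈⁅x⁆ → x∉B (subst (_∈ _) (x∈⁅y⁆⇒x≡y x y∈⁅x⁆) y∈B)

⊆-restore : ∀ {n} {x : Fin n} {X T : Subset n} → X ─ ⁅ x ⁆ ⊆ T → x ∈ T → X ⊆ T
⊆-restore {x = x} X-x⊆T x∈T {y} y∈X with y ∈? ⁅ x ⁆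
... | yes y∈⁅x⁆ = subst (_∈ _) (sym (x∈⁅y⁆⇒x≡y x y∈⁅x⁆)) x∈T
... | no  y∉⁅x⁆ = X-x⊆T (x∈p∧x∉q⇒x∈p─q y∈X y∉⁅x⁆)

SandwichStable : ∀ {n} → Operator n → Set
SandwichStable {n} τ =
  ∀ (B Y X : Subset n) → B ⊆ Y → Y ⊆ X → τ B ≡ τ X → τ Y ≡ τ X

convex⇒sandwich : ∀ {n} {τ : Operator n} → Convexity τ → SandwichStable τ
convex⇒sandwich convex B Y X B⊆Y Y⊆X eq = proj₂ (convex B Y X B⊆Y Y⊆X eq)

-- In a violator space, Y ⊆ X ⊆ τ(X) = τ(B) lets (C22) identify τ(Y) with τ(B).
violator⇒sandwich : ∀ {n} {τ : Operator n} → C1 τ → C22 τ → SandwichStable τ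
violator⇒sandwich {τ = τ} c1 c22 B Y X B⊆Y Y⊆X eq =
  trans (c22 B Y B⊆Y Y⊆τB) eq
  where
  Y⊆τB : Y ⊆ τ B
  Y⊆τB y∈Y = subst (_ ∈_) (sym eq) (c1 X (Y⊆X y∈Y))

extreme⇒in-every-basis : ∀ {n} {τ : Operator n} → C1 τ → SandwichStable τ →
  ∀ (X : Subset n) (x : Fin n) → x ∈ex[ τ ] X → x ∈⋂bases[ τ ] X
extreme⇒in-every-basis {τ = τ} c1 sandwich X x (x∈X , x∉τ[X-x]) B B⊆X τB≡τX =
  decidable-stable (x ∈? B) x∉B⇒⊥
  where
  x∉B⇒⊥ : ¬ (x ∉ B)
  x∉B⇒⊥ x∉B = x∉τ[X-x] (subst (x ∈_) (sym τ[X-x]≡τX) (c1 X x∈X))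
    where
    τ[X-x]≡τX : τ (X ─ ⁅ x ⁆) ≡ τ X
    τ[X-x]≡τX = sandwich B (X ─ ⁅ x ⁆) X (⊆-remove B⊆X x∉B) (p─q⊆p X ⁅ x ⁆) τB≡τX

in-every-basis⇒extreme : ∀ {n} {τ : Operator n} → C1 τ → C22 τ →
  ∀ (X : Subset n) (x : Fin n) → x ∈⋂bases[ τ ] X → x ∈ex[ τ ] X
in-every-basis⇒extreme {τ = τ} c1 c22 X x in-bases =
  in-bases X (λ y∈X → y∈X) refl , x∉τ[X-x]
  where
  x∉τ[X-x] : x ∉ τ (X ─ ⁅ x ⁆)
  x∉τ[X-x] x∈τ[X-x] = x∈q⇒x∉p─q (x∈⁅x⁆ x) (in-bases (X ─ ⁅ x ⁆) (p─q⊆p X ⁅ x ⁆) (sym τX≡τ[X-x]))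
    where
    τX≡τ[X-x] : τ X ≡ τ (X ─ ⁅ x ⁆)
    τX≡τ[X-x] = c22 (X ─ ⁅ x ⁆) X (p─q⊆p X ⁅ x ⁆) (⊆-restore (c1 (X ─ ⁅ x ⁆)) x∈τ[X-x])

mainTheorem15 : ∀ (n : ℕ) (τ : Operator n) →
    ((C1 τ → C22 τ → ∀ (X : Subset n) (x : Fin n) → (x ∈ex[ τ ] X) ⇔ (x ∈⋂bases[ τ ] X))
    × (C1 τ → Convexity τ → ∀ (X : Subset n) (x : Fin n) → x ∈ex[ τ ] X → x ∈⋂bases[ τ ] X))
mainTheorem15 n τ = violatorSpace , convexSpace
  where
  violatorSpace : C1 τ → C22 τ → ∀ (X : Subset n) (x : Fin n) → (x ∈ex[ τ ] X) ⇔ (x ∈⋂bases[ τ ] X)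
  violatorSpace c1 c22 X x =
    mk⇔ (extreme⇒in-every-basis c1 (violator⇒sandwich c1 c22) X x)
        (in-every-basis⇒extreme c1 c22 X x)
  convexSpace : C1 τ → Convexity τ → ∀ (X : Subset n) (x : Fin n) → x ∈ex[ τ ] X → x ∈⋂bases[ τ ] X
  convexSpace c1 convex = extreme⇒in-every-basis c1 (convex⇒sandwich convex)
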